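{- Let $k\ge3$ be an integer such that $p=k+1$ is prime, and let $d$ be an integer with $\frac{k}{2}<d<k$. Then there exists a $k$-gon $[a_0,\dots,a_{k-1}]$ modulo $p$ with monodromy group $C_p^{k-d}\rtimes C_k$.
   Context: A $k$-tuple of positive integers $[a_0,\dots,a_{k-1}]$ ($k\ge3$) is a (geometric) $k$-gon modulo $n$ if $\sum a_i=(k-2)n$, $a_i<2n$, $a_i\ne n$ for all $i$, and $\gcd(a_0,\dots,a_{k-1},n)=1$. Its monodromy group is $N\rtimes C_k$, where $N\subseteq(\mathbb{Z}/n\mathbb{Z})^k$ is the additive subgroup generated by the columns of the circulant matrix with $(i,j)$ entry $a_{(i-j)\bmod k}$, and $C_k$ acts by cyclic permutation of coordinates. "Monodromy group $C_p^r\rtimes C_k$" means $N\cong C_p^r$. -}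

module Defs where

open import Data.Nat using (ℕ; zero; suc; _+_; _*_; _∸_; _<_; _≤_; NonZero)
open import Data.Nat.DivMod using (_%_; _mod_)
open import Data.Nat.GCD using (gcd)
open import Data.Fin using (Fin; toℕ) renaming (zero to fzero; suc to fsuc)
open import Data.Product using (Σ; ∃; _×_)
open import Relation.Binary.PropositionalEquality using (_≡_; _≢_)

sumFin : (k : ℕ) → (Fin k → ℕ) → ℕ
sumFin zero    f = 0
sumFin (suc k) f = f fzero + sumFin k (λ i → f (fsuc i))

gcdAll : (k : ℕ) → (Fin k → ℕ) → ℕ → ℕ
gcdAll zero    a n = n
gcdAll (suc k) a n = gcd (a fzero) (gcdAll k (λ i → a (fsuc i)) n)

_≡_[mod_] : ℕ → ℕ → (n : ℕ) → .{{NonZero n}} → Set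
x ≡ y [mod n ] = x % n ≡ y % n

diffIdx : {k : ℕ} → Fin k → Fin k → Fin k
diffIdx {suc k} i j = ((toℕ i + suc k) ∸ toℕ j) mod (suc k)

record IsKGon (k n : ℕ) (a : Fin k → ℕ) : Set where
  field
    k≥3      : 3 ≤ k
    sumCond  : sumFin k a ≡ (k ∸ 2) * n
    positive : ∀ i → 0 < a i
    bound    : ∀ i → a i < 2 * n
    notN     : ∀ i → a i ≢ n
    coprime  : gcdAll k a n ≡ 1

-- v ∈ N : v lies in the additive subgroup of (ℤ/nℤ)^k generated by the
-- columns of the circulant matrix C with C i j = a ((i - j) mod k).
-- Elements of ℤ/nℤ are represented by natural numbers up to congruence mod n;
-- since (ℤ/nℤ)^k is finite, the generated subgroup is the set of
-- ℕ-linear combinations of the generators.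
InN : (k n : ℕ) .{{_ : NonZero n}} → (Fin k → ℕ) → (Fin k → ℕ) → Set
InN k n a v = ∃ λ (c : Fin k → ℕ) →
  ∀ i → v i ≡ sumFin k (λ j → c j * a (diffIdx i j)) [mod n ]

record NIsoCyclicPower (k n : ℕ) .{{_ : NonZero n}} (a : Fin k → ℕ) (r : ℕ) : Set where
  field
    φ         : (Fin r → ℕ) → (Fin k → ℕ)
    resp      : ∀ x y → (∀ t → x t ≡ y t [mod n ]) → ∀ i → φ x i ≡ φ y i [mod n ]
    additive  : ∀ x y i → φ (λ t → x t + y t) i ≡ φ x i + φ y i [mod n ]
    injective : ∀ x y → (∀ i → φ x i ≡ φ y i [mod n ]) → ∀ t → x t ≡ y t [mod n ]
    into      : ∀ x → InN k n a (φ x)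
    onto      : ∀ v → InN k n a v → ∃ λ x → ∀ i → φ x i ≡ v i [mod n ]

-- Let p = k + 1, r = k − d (so 0 < r and 2r < k), and let g be a primitive root modulo p.
-- The r powers ρₜ = g^(2t+1) are distinct, so the characters i ↦ ρₜⁱ of ℤ/k are orthogonal:
-- Σⱼ ρᵤ⁻ʲ ρₜʲ ≡ k δₜᵤ. Hence if aᵢ ≡ Σₜ cₜ ρₜⁱ with every cₜ ≢ 0, the columns of the
-- circulant matrix of a span the same space as these r independent characters, so N ≅ C_pʳ.
-- We take cₜ = σ C(r−1, t) (−g)^(r−1−t), i.e. aᵢ ≡ σ gⁱ (g²ⁱ − g)^(r−1). This never vanishes
-- because g^(2i−1) ≢ 1 (k is even), and Σᵢ aᵢ ≡ 0 because no ρₜ is 1. The representatives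
-- in (0, p) of the aᵢ sum to m p, and the values of m for σ = 1 and σ = −1 add up to k, so
-- one of them is at most k − 2; adding p to k − 2 − m of the entries gives a k-gon.

module Submission where


open import Defs
open import Data.Nat
open import Data.Nat.Properties
open import Data.Nat.DivMod
open import Data.Nat.Divisibility
open import Data.Nat.Primality
open import Data.Nat.Primality.Factorisation using (factorise)
open import Data.Nat.Coprimality using (Coprime; coprime-divisor; 1-coprimeTo)
import Data.Nat.Coprimality as Coprime
open import Data.Nat.GCD using (gcd[m,n]∣m; gcd[m,n]∣n)
open import Data.Nat.Combinatorics using (_C_; nCk≡n!/k![n-k]!; k![n∸k]!∣n!)
open import Data.Nat.Induction using (<-rec)
open import Data.Nat.ListAction using (product)
open import Data.Nat.Tactic.RingSolver using (solve-∀)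
open import Data.Fin using (Fin; toℕ; fromℕ<) renaming (zero to fzero; suc to fsuc)
open import Data.Fin.Properties
  using (toℕ<n; toℕ-injective; toℕ-fromℕ<; toℕ-inject; pigeonhole; ¬∀⟶∃¬-smallest)
  renaming (suc-injective to fsuc-injective)
open import Data.List using (List; []; _∷_; length; replicate; allFin)
open import Data.List.Properties using (length-replicate)
open import Data.List.Relation.Unary.All using (_∷_)
import Data.List.Relation.Unary.All as All
open import Data.List.Membership.Propositional.Properties using (∈-allFin)
open import Data.List.Extrema.Nat using (argmax; f[xs]≤f[argmax])
import Data.Vec.Functional as Vector
open import Data.Product
open import Data.Sum using (_⊎_; inj₁; inj₂; [_,_]′)
open import Function using (_∘_)
open import Relation.Nullary using (¬_; Dec; yes; no; contradiction)
open import Relation.Nullary.Decidable using (map′; decidable-stable; ¬?)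
open import Relation.Binary using (Setoid)
open import Relation.Binary.PropositionalEquality
  using (_≡_; _≢_; refl; sym; trans; cong; cong₂; subst; subst₂; module ≡-Reasoning)
import Relation.Binary.Reasoning.Setoid as SetoidReasoning
import Algebra.Properties.CommutativeSemiring.Binomial as Binomial
import Algebra.Properties.Semiring.Exp as SemiringExp
import Algebra.Definitions.RawMonoid as RawMonoid

-- Sums, powers and indices

sumFin-cong : ∀ n {f g : Fin n → ℕ} → (∀ i → f i ≡ g i) → sumFin n f ≡ sumFin n g
sumFin-cong zero    f≡g = refl
sumFin-cong (suc n) f≡g = cong₂ _+_ (f≡g fzero) (sumFin-cong n (f≡g ∘ fsuc))

sumFin-distrib-+ : ∀ n (f g : Fin n → ℕ) →
                   sumFin n (λ i → f i + g i) ≡ sumFin n f + sumFin n g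
sumFin-distrib-+ zero    f g = refl
sumFin-distrib-+ (suc n) f g = begin
  f fzero + g fzero + sumFin n (λ i → f (fsuc i) + g (fsuc i))
    ≡⟨ cong (f fzero + g fzero +_) (sumFin-distrib-+ n (f ∘ fsuc) (g ∘ fsuc)) ⟩
  f fzero + g fzero + (sumFin n (f ∘ fsuc) + sumFin n (g ∘ fsuc))
    ≡⟨ +-interchange (f fzero) (g fzero) (sumFin n (f ∘ fsuc)) (sumFin n (g ∘ fsuc)) ⟩
  f fzero + sumFin n (f ∘ fsuc) + (g fzero + sumFin n (g ∘ fsuc)) ∎
  where
  open ≡-Reasoning
  +-interchange : ∀ a b c d → a + b + (c + d) ≡ a + c + (b + d)
  +-interchange = solve-∀

*-distribˡ-sumFin : ∀ n c (f : Fin n → ℕ) → c * sumFin n f ≡ sumFin n (λ i → c * f i)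
*-distribˡ-sumFin zero    c f = *-zeroʳ c
*-distribˡ-sumFin (suc n) c f =
  trans (*-distribˡ-+ c (f fzero) _) (cong (c * f fzero +_) (*-distribˡ-sumFin n c (f ∘ fsuc)))

*-distribʳ-sumFin : ∀ n c (f : Fin n → ℕ) → sumFin n f * c ≡ sumFin n (λ i → f i * c)
*-distribʳ-sumFin n c f =
  trans (*-comm _ c) (trans (*-distribˡ-sumFin n c f) (sumFin-cong n (λ i → *-comm c (f i))))

sumFin-const : ∀ n c → sumFin n (λ _ → c) ≡ n * c
sumFin-const zero    c = refl
sumFin-const (suc n) c = cong (c +_) (sumFin-const n c)

sumFin-zero : ∀ n → sumFin n (λ _ → 0) ≡ 0
sumFin-zero n = trans (sumFin-const n 0) (*-zeroʳ n)

sumFin-swap : ∀ m n (f : Fin m → Fin n → ℕ) →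
              sumFin m (λ i → sumFin n (f i)) ≡ sumFin n (λ j → sumFin m (λ i → f i j))
sumFin-swap zero    n f = sym (sumFin-zero n)
sumFin-swap (suc m) n f = begin
  sumFin n (f fzero) + sumFin m (λ i → sumFin n (f (fsuc i)))
    ≡⟨ cong (sumFin n (f fzero) +_) (sumFin-swap m n (f ∘ fsuc)) ⟩
  sumFin n (f fzero) + sumFin n (λ j → sumFin m (λ i → f (fsuc i) j))
    ≡⟨ sym (sumFin-distrib-+ n (f fzero) _) ⟩
  sumFin n (λ j → f fzero j + sumFin m (λ i → f (fsuc i) j)) ∎
  where open ≡-Reasoning

sumFin-exchange : ∀ m n (f : Fin m → ℕ) (g : Fin n → ℕ) (A : Fin m → Fin n → ℕ) →
  sumFin m (λ i → f i * sumFin n (λ t → g t * A i t)) ≡ sumFin n (λ t → g t * sumFin m (λ i → f i * A i t))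
sumFin-exchange m n f g A = begin
  sumFin m (λ i → f i * sumFin n (λ t → g t * A i t))
    ≡⟨ sumFin-cong m (λ i → *-distribˡ-sumFin n (f i) (λ t → g t * A i t)) ⟩
  sumFin m (λ i → sumFin n (λ t → f i * (g t * A i t)))
    ≡⟨ sumFin-swap m n (λ i t → f i * (g t * A i t)) ⟩
  sumFin n (λ t → sumFin m (λ i → f i * (g t * A i t)))
    ≡⟨ sumFin-cong n (λ t → sumFin-cong m (λ i → x[yz]≡y[xz] (f i) (g t) (A i t))) ⟩
  sumFin n (λ t → sumFin m (λ i → g t * (f i * A i t)))
    ≡⟨ sumFin-cong n (λ t → *-distribˡ-sumFin m (g t) (λ i → f i * A i t)) ⟨
  sumFin n (λ t → g t * sumFin m (λ i → f i * A i t)) ∎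
  where
  open ≡-Reasoning
  x[yz]≡y[xz] : ∀ x y z → x * (y * z) ≡ y * (x * z)
  x[yz]≡y[xz] = solve-∀

^-distribʳ-* : ∀ x y m → (x * y) ^ m ≡ x ^ m * y ^ m
^-distribʳ-* x y zero    = refl
^-distribʳ-* x y (suc m) = trans (cong (x * y *_) (^-distribʳ-* x y m)) (interchange x y (x ^ m) (y ^ m))
  where
  interchange : ∀ a b c d → a * b * (c * d) ≡ a * c * (b * d)
  interchange = solve-∀

geometric-telescope : ∀ q m → q * sumFin m (λ j → q ^ toℕ j) + 1 ≡ sumFin m (λ j → q ^ toℕ j) + q ^ m
geometric-telescope q zero    = cong (_+ 1) (*-zeroʳ q)
geometric-telescope q (suc m) = begin
  q * (1 + qG) + 1        ≡⟨ cong (λ z → q * (1 + z) + 1) (*-distribˡ-sumFin m q (λ j → q ^ toℕ j)) ⟨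
  q * (1 + q * G) + 1     ≡⟨ rearrange₁ q G ⟩
  1 + q * (q * G + 1)     ≡⟨ cong (λ z → 1 + q * z) (geometric-telescope q m) ⟩
  1 + q * (G + q ^ m)     ≡⟨ rearrange₂ q G (q ^ m) ⟩
  1 + q * G + q * q ^ m   ≡⟨ cong (λ z → 1 + z + q * q ^ m) (*-distribˡ-sumFin m q (λ j → q ^ toℕ j)) ⟩
  1 + qG + q ^ suc m      ∎
  where
  open ≡-Reasoning
  G : ℕ
  G = sumFin m (λ j → q ^ toℕ j)
  qG : ℕ
  qG = sumFin m (λ j → q * q ^ toℕ j)
  rearrange₁ : ∀ q G → q * (1 + q * G) + 1 ≡ 1 + q * (q * G + 1)
  rearrange₁ = solve-∀
  rearrange₂ : ∀ q G x → 1 + q * (G + x) ≡ 1 + q * G + q * x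
  rearrange₂ = solve-∀

binomial-theorem : ∀ n x y →
  (x + y) ^ n ≡ sumFin (suc n) (λ t → (n C toℕ t) * (x ^ toℕ t * y ^ (n ∸ toℕ t)))
binomial-theorem n x y = begin
  (x + y) ^ n                     ≡⟨ sym (^≡^ (x + y) n) ⟩
  (x + y) ^ₛ n                    ≡⟨ B.theorem n x y ⟩
  B.binomialExpansion x y n       ≡⟨ foldr≡sumFin (suc n) (B.binomialTerm x y n) ⟩
  sumFin (suc n) (B.binomialTerm x y n)
    ≡⟨ sumFin-cong (suc n) (λ t → trans (×≡* (n C toℕ t) _)
         (cong ((n C toℕ t) *_) (cong₂ _*_ (^≡^ x (toℕ t)) (^≡^ y (n ∸ toℕ t))))) ⟩
  sumFin (suc n) (λ t → (n C toℕ t) * (x ^ toℕ t * y ^ (n ∸ toℕ t))) ∎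
  where
  open ≡-Reasoning
  module B = Binomial +-*-commutativeSemiring
  open SemiringExp +-*-semiring renaming (_^_ to _^ₛ_)

  ^≡^ : ∀ x n → x ^ₛ n ≡ x ^ n
  ^≡^ x zero    = refl
  ^≡^ x (suc n) = cong (x *_) (^≡^ x n)

  ×≡* : ∀ n x → RawMonoid._×_ +-0-rawMonoid n x ≡ n * x
  ×≡* zero    x = refl
  ×≡* (suc n) x = cong (x +_) (×≡* n x)

  foldr≡sumFin : ∀ m (f : Fin m → ℕ) → Vector.foldr _+_ 0 f ≡ sumFin m f
  foldr≡sumFin zero    f = refl
  foldr≡sumFin (suc m) f = cong (f fzero +_) (foldr≡sumFin m (f ∘ fsuc))

below : ℕ → ℕ → ℕ
below _       zero    = 0
below zero    (suc L) = 1
below (suc i) (suc L) = below i L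

below≤1 : ∀ i L → below i L ≤ 1
below≤1 _       zero    = z≤n
below≤1 zero    (suc L) = s≤s z≤n
below≤1 (suc i) (suc L) = below≤1 i L

sumFin-below : ∀ n L → L ≤ n → sumFin n (λ i → below (toℕ i) L) ≡ L
sumFin-below n       zero    _         = sumFin-zero n
sumFin-below (suc n) (suc L) (s≤s L≤n) = cong suc (sumFin-below n L L≤n)

argmax-Fin : ∀ {n} → 0 < n → (f : Fin n → ℕ) → ∃ λ i → ∀ j → f j ≤ f i
argmax-Fin {suc n} _ f = argmax f fzero (allFin (suc n)) ,
  λ j → All.lookup (f[xs]≤f[argmax] {f = f} fzero (allFin (suc n))) (∈-allFin j)

toℕ-diffIdx : ∀ {k} .{{_ : NonZero k}} (i j : Fin k) → toℕ (diffIdx i j) ≡ (toℕ i + k ∸ toℕ j) % k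
toℕ-diffIdx {suc k} i j = toℕ-fromℕ< _

-- Divisibility

prime⇒1<p : ∀ {q} → Prime q → 1 < q
prime⇒1<p {q} q-prime = nonTrivial⇒n>1 q {{prime⇒nonTrivial q-prime}}

∃prime∣ : ∀ {b} → 1 < b → ∃ λ q → Prime q × q ∣ b
∃prime∣ {b} 1<b with factorise b {{>-nonZero (<-trans z<s 1<b)}}
... | record { factors = []     ; isFactorisation = b≡1 } = contradiction b≡1 (>⇒≢ 1<b)
... | record { factors = q ∷ qs ; isFactorisation = b≡q*qs ; factorsPrime = q-prime ∷ _ } =
  q , q-prime , divides (product qs) (trans b≡q*qs (*-comm q (product qs)))

prime∤⇒coprime : ∀ {q n} → Prime q → ¬ q ∣ n → Coprime q n
prime∤⇒coprime q-prime q∤n (i∣q , i∣n) with prime⇒irreducible q-prime i∣q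
... | inj₁ i≡1 = i≡1
... | inj₂ refl = contradiction i∣n q∤n

coprime-^ˡ : ∀ {q n} → Coprime q n → ∀ e → Coprime (q ^ e) n
coprime-^ˡ _ zero = 1-coprimeTo _
coprime-^ˡ {q} {n} q⊥n (suc e) {i} (i∣q*qᵉ , i∣n) =
  coprime-^ˡ q⊥n e (coprime-divisor i⊥q i∣q*qᵉ , i∣n)
  where
  i⊥q : Coprime i q
  i⊥q (j∣i , j∣q) = q⊥n (j∣q , ∣-trans j∣i i∣n)

coprime⇒*∣ : ∀ {a b m} → Coprime a b → a ∣ m → b ∣ m → a * b ∣ m
coprime⇒*∣ {a} {b} a⊥b (divides c refl) b∣c*a =
  subst (a * b ∣_) (*-comm a c) (*-monoʳ-∣ a (coprime-divisor (Coprime.sym a⊥b) (subst (b ∣_) (*-comm c a) b∣c*a)))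

proper-factor : ∀ {n c q} → 0 < n → 1 < q → n ≡ c * q → 0 < c × c < n
proper-factor {c = zero}  0<n _   n≡0   = contradiction n≡0 (>⇒≢ 0<n)
proper-factor {c = suc c} _   1<q n≡c*q = z<s , subst (suc c <_) (sym n≡c*q) (m<m*n (suc c) _ 1<q)

factor-out : ∀ {q} → Prime q → ∀ n → 0 < n → ∃₂ λ e m → n ≡ q ^ e * m × ¬ q ∣ m
factor-out {q} q-prime = <-rec _ go
  where
  go : ∀ n → (∀ {c} → c < n → 0 < c → ∃₂ λ e m → c ≡ q ^ e * m × ¬ q ∣ m) →
       0 < n → ∃₂ λ e m → n ≡ q ^ e * m × ¬ q ∣ m
  go n rec 0<n with q ∣? n
  ... | no  q∤n = 0 , n , sym (+-identityʳ n) , q∤n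
  ... | yes (divides c n≡c*q) with proper-factor {c = c} 0<n (prime⇒1<p q-prime) n≡c*q
  ...   | 0<c , c<n with rec c<n 0<c
  ...     | e , m , c≡qᵉm , q∤m = suc e , m , n≡qᵉ⁺¹m , q∤m
    where
    n≡qᵉ⁺¹m : n ≡ q ^ suc e * m
    n≡qᵉ⁺¹m = trans n≡c*q (trans (cong (_* q) c≡qᵉm) (rearrange (q ^ e) m q))
      where
      rearrange : ∀ x m q → x * m * q ≡ q * x * m
      rearrange = solve-∀

∤⇒prime-power∤ : ∀ {a} b → 0 < b → ¬ b ∣ a → ∃ λ q → Prime q × ∃ λ e → q ^ e ∣ b × ¬ q ^ e ∣ a
∤⇒prime-power∤ {a} = <-rec _ go
  where
  Witness : ℕ → Set
  Witness b = ∃ λ q → Prime q × ∃ λ e → q ^ e ∣ b × ¬ q ^ e ∣ a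

  1<b : ∀ {b} → 0 < b → ¬ b ∣ a → 1 < b
  1<b {suc zero}    _ 1∤a = contradiction (1∣ a) 1∤a
  1<b {suc (suc b)} _ _   = s≤s (s≤s z≤n)

  go : ∀ b → (∀ {c} → c < b → 0 < c → ¬ c ∣ a → Witness c) → 0 < b → ¬ b ∣ a → Witness b
  go b rec 0<b b∤a with ∃prime∣ (1<b 0<b b∤a)
  ... | q , q-prime , divides c b≡c*q with proper-factor {c = c} 0<b (prime⇒1<p q-prime) b≡c*q | c ∣? a
  ...   | 0<c , c<b | no c∤a with rec c<b 0<c c∤a
  ...     | q′ , q′-prime , e , q′ᵉ∣c , q′ᵉ∤a =
    q′ , q′-prime , e , ∣-trans q′ᵉ∣c (divides q (trans b≡c*q (*-comm c q))) , q′ᵉ∤a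
  go b rec 0<b b∤a | q , q-prime , divides c b≡c*q | _ | yes c∣a with factor-out q-prime b 0<b
  ...   | e , m , b≡qᵉm , q∤m = q , q-prime , e , divides m (trans b≡qᵉm (*-comm (q ^ e) m)) , qᵉ∤a e b≡qᵉm
    where
    instance
      q≢0 : NonZero q
      q≢0 = prime⇒nonZero q-prime
    qᵉ∤a : ∀ e → b ≡ q ^ e * m → ¬ q ^ e ∣ a
    qᵉ∤a zero     b≡m   _    = q∤m (subst (q ∣_) (trans b≡m (+-identityʳ m)) (divides c b≡c*q))
    qᵉ∤a (suc e′) b≡qqᵉ′m qᵉ∣a = b∤a (subst (_∣ a) (sym b≡qqᵉ′m)
      (coprime⇒*∣ (coprime-^ˡ (prime∤⇒coprime q-prime q∤m) (suc e′)) qᵉ∣a (∣-trans m∣c c∣a)))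
      where
      c≡qᵉ′m : c ≡ q ^ e′ * m
      c≡qᵉ′m = *-cancelʳ-≡ c (q ^ e′ * m) q (trans (sym b≡c*q) (trans b≡qqᵉ′m (rearrange q (q ^ e′) m)))
        where
        rearrange : ∀ q x m → q * x * m ≡ x * m * q
        rearrange = solve-∀
      m∣c : m ∣ c
      m∣c = divides (q ^ e′) c≡qᵉ′m

2∣⊎2∣suc : ∀ m → 2 ∣ m ⊎ 2 ∣ suc m
2∣⊎2∣suc zero    = inj₁ (divides 0 refl)
2∣⊎2∣suc (suc m) with 2∣⊎2∣suc m
... | inj₁ 2∣m   = inj₂ (∣m∣n⇒∣m+n (∣-refl {2}) 2∣m)
... | inj₂ 2∣1+m = inj₁ 2∣1+m

2∤1+2m : ∀ m → ¬ 2 ∣ suc (2 * m)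
2∤1+2m m 2∣1+2m = contradiction (∣1⇒≡1 (∣m+n∣m⇒∣n (subst (2 ∣_) (+-comm 1 (2 * m)) 2∣1+2m) (m∣m*n m))) λ ()

odd-prime⇒even : ∀ {k} → 3 ≤ k → Prime (suc k) → 2 ∣ k
odd-prime⇒even {k} 3≤k p-prime with 2∣⊎2∣suc k
... | inj₁ 2∣k   = 2∣k
... | inj₂ 2∣1+k with prime⇒irreducible p-prime 2∣1+k
...   | inj₁ ()
...   | inj₂ 2≡1+k = contradiction (subst (3 ≤_) (suc-injective (sym 2≡1+k)) 3≤k) λ { (s≤s ()) }

gcdAll∣n : ∀ m (a : Fin m → ℕ) n → gcdAll m a n ∣ n
gcdAll∣n zero    a n = ∣-refl
gcdAll∣n (suc m) a n = ∣-trans (gcd[m,n]∣n (a fzero) (gcdAll m (a ∘ fsuc) n)) (gcdAll∣n m (a ∘ fsuc) n)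

gcdAll∣a : ∀ m (a : Fin m → ℕ) n i → gcdAll m a n ∣ a i
gcdAll∣a (suc m) a n fzero    = gcd[m,n]∣m (a fzero) (gcdAll m (a ∘ fsuc) n)
gcdAll∣a (suc m) a n (fsuc i) = ∣-trans (gcd[m,n]∣n (a fzero) (gcdAll m (a ∘ fsuc) n)) (gcdAll∣a m (a ∘ fsuc) n i)

-- Monic polynomials

-- evalMonic (c₀ ∷ … ∷ cₘ₋₁ ∷ []) y = c₀ + c₁ y + … + cₘ₋₁ yᵐ⁻¹ + yᵐ.
evalMonic : List ℕ → ℕ → ℕ
evalMonic []       y = 1
evalMonic (c ∷ cs) y = c + y * evalMonic cs y

-- The quotient of P by y − u (synthetic division; the remainder is P(u)).
divideMonic : ℕ → List ℕ → List ℕ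
divideMonic u []                 = []
divideMonic u (c ∷ [])           = []
divideMonic u (c ∷ cs@(_ ∷ _)) = evalMonic cs u ∷ divideMonic u cs

divideMonic-length : ∀ u c cs → length (divideMonic u (c ∷ cs)) ≡ length cs
divideMonic-length u c []        = refl
divideMonic-length u c (c′ ∷ cs) = cong suc (divideMonic-length u c′ cs)

-- P(y) − P(u) = (y − u) Q(y), with both sides moved so that no subtraction occurs.
divideMonic-correct : ∀ u y c cs → let P = c ∷ cs ; Q = evalMonic (divideMonic u P) y in
                      evalMonic P y + u * Q ≡ y * Q + evalMonic P u
divideMonic-correct u y c []        = degree-one u y c
  where
  degree-one : ∀ u y c → c + y * 1 + u * 1 ≡ y * 1 + (c + u * 1)
  degree-one = solve-∀
divideMonic-correct u y c (c′ ∷ cs) = begin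
  c + y * P + u * (R + y * Q)   ≡⟨ rearrange₁ c y P u R Q ⟩
  c + u * R + y * (P + u * Q)   ≡⟨ cong (λ z → c + u * R + y * z) (divideMonic-correct u y c′ cs) ⟩
  c + u * R + y * (y * Q + R)   ≡⟨ rearrange₂ c y u R Q ⟩
  y * (R + y * Q) + (c + u * R) ∎
  where
  open ≡-Reasoning
  P : ℕ
  P = evalMonic (c′ ∷ cs) y
  Q : ℕ
  Q = evalMonic (divideMonic u (c′ ∷ cs)) y
  R : ℕ
  R = evalMonic (c′ ∷ cs) u
  rearrange₁ : ∀ c y P u R Q → c + y * P + u * (R + y * Q) ≡ c + u * R + y * (P + u * Q)
  rearrange₁ = solve-∀
  rearrange₂ : ∀ c y u R Q → c + u * R + y * (y * Q + R) ≡ y * (R + y * Q) + (c + u * R)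
  rearrange₂ = solve-∀

evalMonic-replicate : ∀ m y → evalMonic (replicate m 0) y ≡ y ^ m
evalMonic-replicate zero    y = refl
evalMonic-replicate (suc m) y = cong (y *_) (evalMonic-replicate m y)

-- Arithmetic modulo n

module Congruence (n : ℕ) .{{_ : NonZero n}} where

  -- A record rather than x % n ≡ y % n, so that x and y can be inferred.
  infix 4 _≈_ _≉_
  record _≈_ (x y : ℕ) : Set where
    constructor mk≈
    field congruent : x ≡ y [mod n ]
  open _≈_ public

  _≉_ : ℕ → ℕ → Set
  x ≉ y = ¬ x ≈ y

  ≈-refl : ∀ {x} → x ≈ x
  ≈-refl = mk≈ refl

  ≈-sym : ∀ {x y} → x ≈ y → y ≈ x
  ≈-sym (mk≈ e) = mk≈ (sym e)

  ≈-trans : ∀ {x y z} → x ≈ y → y ≈ z → x ≈ z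
  ≈-trans (mk≈ e) (mk≈ f) = mk≈ (trans e f)

  ≈-reflexive : ∀ {x y} → x ≡ y → x ≈ y
  ≈-reflexive e = mk≈ (cong (_% n) e)

  ≈-setoid : Setoid _ _
  ≈-setoid = record
    { Carrier = ℕ ; _≈_ = _≈_
    ; isEquivalence = record { refl = ≈-refl ; sym = ≈-sym ; trans = ≈-trans } }

  module ≈-Reasoning = SetoidReasoning ≈-setoid

  %-≈ : ∀ x → x % n ≈ x
  %-≈ x = mk≈ (m%n%n≡m%n x n)

  +-cong : ∀ {a b c d} → a ≈ b → c ≈ d → a + c ≈ b + d
  +-cong {a} {b} {c} {d} (mk≈ e) (mk≈ f) = mk≈ (begin
    (a + c) % n             ≡⟨ %-distribˡ-+ a c n ⟩
    (a % n + c % n) % n     ≡⟨ cong₂ (λ u v → (u + v) % n) e f ⟩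
    (b % n + d % n) % n     ≡⟨ %-distribˡ-+ b d n ⟨
    (b + d) % n             ∎)
    where open ≡-Reasoning

  *-cong : ∀ {a b c d} → a ≈ b → c ≈ d → a * c ≈ b * d
  *-cong {a} {b} {c} {d} (mk≈ e) (mk≈ f) = mk≈ (begin
    (a * c) % n             ≡⟨ %-distribˡ-* a c n ⟩
    (a % n * (c % n)) % n   ≡⟨ cong₂ (λ u v → (u * v) % n) e f ⟩
    (b % n * (d % n)) % n   ≡⟨ %-distribˡ-* b d n ⟨
    (b * d) % n             ∎)
    where open ≡-Reasoning

  *-congˡ : ∀ {a b} c → a ≈ b → c * a ≈ c * b
  *-congˡ c = *-cong (≈-refl {c})

  *-congʳ : ∀ {a b} c → a ≈ b → a * c ≈ b * c
  *-congʳ c a≈b = *-cong a≈b ≈-refl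

  ^-congˡ : ∀ {a b} m → a ≈ b → a ^ m ≈ b ^ m
  ^-congˡ zero    _   = ≈-refl
  ^-congˡ (suc m) a≈b = *-cong a≈b (^-congˡ m a≈b)

  sumFin-cong-≈ : ∀ m {f g : Fin m → ℕ} → (∀ i → f i ≈ g i) → sumFin m f ≈ sumFin m g
  sumFin-cong-≈ zero    _   = ≈-refl
  sumFin-cong-≈ (suc m) f≈g = +-cong (f≈g fzero) (sumFin-cong-≈ m (f≈g ∘ fsuc))

  sumFin-delta : ∀ m (f : Fin m → ℕ) u → (∀ t → t ≢ u → f t ≈ 0) → sumFin m f ≈ f u
  sumFin-delta (suc m) f fzero    f≈0 = begin
    f fzero + sumFin m (f ∘ fsuc) ≈⟨ +-cong ≈-refl (sumFin-cong-≈ m (λ t → f≈0 (fsuc t) λ ())) ⟩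
    f fzero + sumFin m (λ _ → 0)  ≡⟨ cong (f fzero +_) (sumFin-zero m) ⟩
    f fzero + 0                   ≡⟨ +-identityʳ (f fzero) ⟩
    f fzero                       ∎
    where open ≈-Reasoning
  sumFin-delta (suc m) f (fsuc u) f≈0 =
    +-cong (f≈0 fzero λ ()) (sumFin-delta m (f ∘ fsuc) u λ t t≢u → f≈0 (fsuc t) (t≢u ∘ fsuc-injective))

  0%n≡0 : 0 % n ≡ 0
  0%n≡0 = m*n%n≡0 0 n

  ∣⇒≈0 : ∀ {x} → n ∣ x → x ≈ 0
  ∣⇒≈0 {x} n∣x = mk≈ (trans (n∣m⇒m%n≡0 x n n∣x) (sym 0%n≡0))

  ≈0⇒∣ : ∀ {x} → x ≈ 0 → n ∣ x
  ≈0⇒∣ {x} (mk≈ e) = m%n≡0⇒n∣m x n (trans e 0%n≡0)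

  n*x≈0 : ∀ x → n * x ≈ 0
  n*x≈0 x = ∣⇒≈0 (m∣m*n x)

  ≈⇒∣∸ : ∀ {a b} → a ≈ b → n ∣ b ∸ a
  ≈⇒∣∸ {a} {b} (mk≈ e) = divides (b / n ∸ a / n) (begin
    b ∸ a                                   ≡⟨ cong₂ _∸_ (m≡m%n+[m/n]*n b n) (m≡m%n+[m/n]*n a n) ⟩
    (b % n + b / n * n) ∸ (a % n + a / n * n) ≡⟨ cong (λ z → (b % n + b / n * n) ∸ (z + a / n * n)) e ⟩
    (b % n + b / n * n) ∸ (b % n + a / n * n) ≡⟨ [m+n]∸[m+o]≡n∸o (b % n) (b / n * n) (a / n * n) ⟩
    b / n * n ∸ a / n * n                   ≡⟨ *-distribʳ-∸ n (b / n) (a / n) ⟨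
    (b / n ∸ a / n) * n                     ∎)
    where open ≡-Reasoning

  ∣∸⇒≈ : ∀ {a b} → a ≤ b → n ∣ b ∸ a → a ≈ b
  ∣∸⇒≈ {a} {b} a≤b n∣b∸a = mk≈ (sym (begin
    b % n             ≡⟨ cong (_% n) (m+[n∸m]≡n a≤b) ⟨
    (a + (b ∸ a)) % n ≡⟨ %-remove-+ʳ a n∣b∸a ⟩
    a % n             ∎))
    where open ≡-Reasoning

  wlog-≤ : {R : ℕ → ℕ → Set} → (∀ {x y} → R x y → R y x) →
           (∀ {x y} → x ≤ y → R x y → x ≈ y) → ∀ {x y} → R x y → x ≈ y
  wlog-≤ R-sym ordered {x} {y} r with ≤-total x y
  ... | inj₁ x≤y = ordered x≤y r
  ... | inj₂ y≤x = ≈-sym (ordered y≤x (R-sym r))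

  +-cancelʳ-≈ : ∀ {a b} c → a + c ≈ b + c → a ≈ b
  +-cancelʳ-≈ c = wlog-≤ ≈-sym cancel
    where
    cancel : ∀ {x y} → x ≤ y → x + c ≈ y + c → x ≈ y
    cancel {x} {y} x≤y e = ∣∸⇒≈ x≤y (subst (n ∣_) [y+c]∸[x+c]≡y∸x (≈⇒∣∸ e))
      where
      [y+c]∸[x+c]≡y∸x : (y + c) ∸ (x + c) ≡ y ∸ x
      [y+c]∸[x+c]≡y∸x = trans (cong₂ _∸_ (+-comm y c) (+-comm x c)) ([m+n]∸[m+o]≡n∸o c y x)

  ^-*-≈1 : ∀ {y} e → y ^ e ≈ 1 → ∀ c → y ^ (e * c) ≈ 1
  ^-*-≈1 {y} e yᵉ≈1 c = begin
    y ^ (e * c) ≡⟨ ^-*-assoc y e c ⟨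
    (y ^ e) ^ c ≈⟨ ^-congˡ c yᵉ≈1 ⟩
    1 ^ c       ≡⟨ ^-zeroˡ c ⟩
    1           ∎
    where open ≈-Reasoning

  ^-%-≈ : ∀ {y} e .{{_ : NonZero e}} → y ^ e ≈ 1 → ∀ m → y ^ m ≈ y ^ (m % e)
  ^-%-≈ {y} e yᵉ≈1 m = begin
    y ^ m                           ≡⟨ cong (y ^_) (trans (m≡m%n+[m/n]*n m e) (cong (m % e +_) (*-comm (m / e) e))) ⟩
    y ^ (m % e + e * (m / e))       ≡⟨ ^-distribˡ-+-* y (m % e) (e * (m / e)) ⟩
    y ^ (m % e) * y ^ (e * (m / e)) ≈⟨ *-congˡ (y ^ (m % e)) (^-*-≈1 e yᵉ≈1 (m / e)) ⟩
    y ^ (m % e) * 1                 ≡⟨ *-identityʳ (y ^ (m % e)) ⟩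
    y ^ (m % e)                     ∎
    where open ≈-Reasoning

module PrimeModulus (p : ℕ) (p-prime : Prime p) where

  instance
    p≢0 : NonZero p
    p≢0 = prime⇒nonZero p-prime

  open Congruence p public

  infix 4 _≈?_
  _≈?_ : ∀ a b → Dec (a ≈ b)
  a ≈? b = map′ mk≈ congruent (a % p ≟ b % p)

  *-≉0 : ∀ {a b} → a ≉ 0 → b ≉ 0 → a * b ≉ 0
  *-≉0 {a} {b} a≉0 b≉0 ab≈0 with euclidsLemma a b p-prime (≈0⇒∣ ab≈0)
  ... | inj₁ p∣a = a≉0 (∣⇒≈0 p∣a)
  ... | inj₂ p∣b = b≉0 (∣⇒≈0 p∣b)

  1≉0 : 1 ≉ 0
  1≉0 1≈0 = nonTrivial⇒≢1 {{prime⇒nonTrivial p-prime}} (∣1⇒≡1 (≈0⇒∣ 1≈0))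

  ^-≉0 : ∀ {a} m → a ≉ 0 → a ^ m ≉ 0
  ^-≉0 zero    _   = 1≉0
  ^-≉0 (suc m) a≉0 = *-≉0 a≉0 (^-≉0 m a≉0)

  *-cancelʳ-≈ : ∀ {a b} c → c ≉ 0 → a * c ≈ b * c → a ≈ b
  *-cancelʳ-≈ c c≉0 = wlog-≤ ≈-sym cancel
    where
    cancel : ∀ {x y} → x ≤ y → x * c ≈ y * c → x ≈ y
    cancel {x} {y} x≤y e
      with euclidsLemma (y ∸ x) c p-prime (subst (p ∣_) (sym (*-distribʳ-∸ c y x)) (≈⇒∣∸ e))
    ... | inj₁ p∣y∸x = ∣∸⇒≈ x≤y p∣y∸x
    ... | inj₂ p∣c   = contradiction (∣⇒≈0 p∣c) c≉0

  *-cancelˡ-≈ : ∀ {a b} c → c ≉ 0 → c * a ≈ c * b → a ≈ b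
  *-cancelˡ-≈ {a} {b} c c≉0 e = *-cancelʳ-≈ c c≉0 (subst₂ _≈_ (*-comm c a) (*-comm c b) e)

  geometric-sum≈0 : ∀ {q} m → q ^ m ≈ 1 → q ≉ 1 → sumFin m (λ j → q ^ toℕ j) ≈ 0
  geometric-sum≈0 {q} m qᵐ≈1 q≉1 = decidable-stable (G ≈? 0) (λ G≉0 → q≉1 (*-cancelʳ-≈ G G≉0 qG≈1G))
    where
    G : ℕ
    G = sumFin m (λ j → q ^ toℕ j)
    qG≈1G : q * G ≈ 1 * G
    qG≈1G = +-cancelʳ-≈ 1 (begin
      q * G + 1   ≡⟨ geometric-telescope q m ⟩
      G + q ^ m   ≈⟨ +-cong ≈-refl qᵐ≈1 ⟩
      G + 1       ≡⟨ cong (_+ 1) (*-identityˡ G) ⟨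
      1 * G + 1   ∎)
      where open ≈-Reasoning

  0<m<p⇒m≉0 : ∀ {m} → 0 < m → m < p → m ≉ 0
  0<m<p⇒m≉0 {suc m} _ m<p (mk≈ e) = 1+n≢0 (trans (sym (m<n⇒m%n≡m m<p)) (trans e 0%n≡0))

  !-≉0 : ∀ m → m < p → m ! ≉ 0
  !-≉0 zero    _   = 1≉0
  !-≉0 (suc m) m<p = *-≉0 (0<m<p⇒m≉0 z<s m<p) (!-≉0 m (<-trans (n<1+n m) m<p))

  C-≉0 : ∀ {n t} → n < p → t ≤ n → n C t ≉ 0
  C-≉0 {n} {t} n<p t≤n nCt≈0 = !-≉0 n n<p (begin
    n !                         ≡⟨ n!≡nCt*t![n∸t]! ⟩
    (n C t) * (t ! * (n ∸ t) !) ≈⟨ *-congʳ (t ! * (n ∸ t) !) nCt≈0 ⟩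
    0                           ∎)
    where
    open ≈-Reasoning
    instance
      t![n∸t]!≢0 : NonZero (t ! * (n ∸ t) !)
      t![n∸t]!≢0 = t !* (n ∸ t) !≢0
    n!≡nCt*t![n∸t]! : n ! ≡ (n C t) * (t ! * (n ∸ t) !)
    n!≡nCt*t![n∸t]! = sym (trans (cong (_* (t ! * (n ∸ t) !)) (nCk≡n!/k![n-k]! t≤n))
                                 (m/n*n≡m (k![n∸k]!∣n! t≤n)))

  monic-roots≤degree : ∀ cs m (root : Fin m → ℕ) → (∀ i j → root i ≈ root j → i ≡ j) →
                       (∀ i → evalMonic cs (root i) ≈ 0) → m ≤ length cs
  monic-roots≤degree cs       zero    _    _         _     = z≤n
  monic-roots≤degree []       (suc m) _    _         roots = contradiction (roots fzero) 1≉0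
  monic-roots≤degree (c ∷ cs) (suc m) root injective roots =
    s≤s (subst (m ≤_) (divideMonic-length u c cs)
      (monic-roots≤degree (divideMonic u (c ∷ cs)) m (root ∘ fsuc)
        (λ i j e → fsuc-injective (injective (fsuc i) (fsuc j) e)) quotient-roots))
    where
    u : ℕ
    u = root fzero
    quotient-roots : ∀ i → evalMonic (divideMonic u (c ∷ cs)) (root (fsuc i)) ≈ 0
    quotient-roots i = decidable-stable (Q ≈? 0) λ Q≉0 →
      contradiction (injective fzero (fsuc i) (*-cancelʳ-≈ Q Q≉0 uQ≈wQ)) λ ()
      where
      w : ℕ
      w = root (fsuc i)
      Q : ℕ
      Q = evalMonic (divideMonic u (c ∷ cs)) w
      uQ≈wQ : u * Q ≈ w * Q
      uQ≈wQ = begin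
        u * Q                          ≡⟨⟩
        0 + u * Q                      ≈⟨ +-cong (≈-sym (roots (fsuc i))) ≈-refl ⟩
        evalMonic (c ∷ cs) w + u * Q   ≡⟨ divideMonic-correct u w c cs ⟩
        w * Q + evalMonic (c ∷ cs) u   ≈⟨ +-cong ≈-refl (roots fzero) ⟩
        w * Q + 0                      ≡⟨ +-identityʳ (w * Q) ⟩
        w * Q                          ∎
        where open ≈-Reasoning

-- The multiplicative group modulo p = k + 1

module Units (k : ℕ) (p-prime : Prime (suc k)) where

  open PrimeModulus (suc k) p-prime public

  residue : Fin k → ℕ
  residue i = suc (toℕ i)

  residue%p : ∀ i → residue i % suc k ≡ residue i
  residue%p i = m<n⇒m%n≡m (s≤s (toℕ<n i))

  residue≉0 : ∀ i → residue i ≉ 0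
  residue≉0 i = 0<m<p⇒m≉0 z<s (s≤s (toℕ<n i))

  residue-injective : ∀ i j → residue i ≈ residue j → i ≡ j
  residue-injective i j (mk≈ e) =
    toℕ-injective (suc-injective (trans (sym (residue%p i)) (trans e (residue%p j))))

  ≉0⇒%≢0 : ∀ {y} → y ≉ 0 → y % suc k ≢ 0
  ≉0⇒%≢0 y≉0 e = y≉0 (mk≈ (trans e (sym 0%n≡0)))

  suc-pred-% : ∀ {y} → y ≉ 0 → suc (pred (y % suc k)) ≡ y % suc k
  suc-pred-% {y} y≉0 = suc-pred (y % suc k) {{≢-nonZero (≉0⇒%≢0 y≉0)}}

  index : ∀ y → y ≉ 0 → Fin k
  index y y≉0 = fromℕ< (s<s⁻¹ (subst (_< suc k) (sym (suc-pred-% y≉0)) (m%n<n y (suc k))))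

  residue-index : ∀ y y≉0 → residue (index y y≉0) ≈ y
  residue-index y y≉0 = ≈-trans (≈-reflexive (trans (cong suc (toℕ-fromℕ< _)) (suc-pred-% y≉0))) (%-≈ y)

  record HasOrder (y n : ℕ) : Set where
    field
      ≈1⇒∣ : ∀ {m} → y ^ m ≈ 1 → n ∣ m
      ∣⇒≈1 : ∀ {m} → n ∣ m → y ^ m ≈ 1
  open HasOrder public

  ^-≈1-exists : ∀ {y} → y ≉ 0 → ∃ λ n → 0 < n × n ≤ k × y ^ n ≈ 1
  ^-≈1-exists {y} y≉0 with pigeonhole (n<1+n k) (λ i → index (y ^ toℕ i) (^-≉0 (toℕ i) y≉0))
  ... | i , j , i<j , same-index = toℕ j ∸ toℕ i , m<n⇒0<n∸m i<j ,
    ≤-trans (m∸n≤m (toℕ j) (toℕ i)) (s≤s⁻¹ (toℕ<n j)) ,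
    ≈-sym (*-cancelˡ-≈ (y ^ toℕ i) (^-≉0 (toℕ i) y≉0) yⁱ≈yⁱyʲ⁻ⁱ)
    where
    open ≈-Reasoning
    yⁱ≈yⁱyʲ⁻ⁱ : y ^ toℕ i * 1 ≈ y ^ toℕ i * y ^ (toℕ j ∸ toℕ i)
    yⁱ≈yⁱyʲ⁻ⁱ = begin
      y ^ toℕ i * 1                     ≡⟨ *-identityʳ (y ^ toℕ i) ⟩
      y ^ toℕ i                         ≈⟨ residue-index (y ^ toℕ i) (^-≉0 (toℕ i) y≉0) ⟨
      residue (index (y ^ toℕ i) (^-≉0 (toℕ i) y≉0)) ≡⟨ cong residue same-index ⟩
      residue (index (y ^ toℕ j) (^-≉0 (toℕ j) y≉0)) ≈⟨ residue-index (y ^ toℕ j) (^-≉0 (toℕ j) y≉0) ⟩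
      y ^ toℕ j                         ≡⟨ cong (y ^_) (m+[n∸m]≡n (<⇒≤ i<j)) ⟨
      y ^ (toℕ i + (toℕ j ∸ toℕ i))     ≡⟨ ^-distribˡ-+-* y (toℕ i) (toℕ j ∸ toℕ i) ⟩
      y ^ toℕ i * y ^ (toℕ j ∸ toℕ i)   ∎

  order-exists : ∀ {y} → y ≉ 0 → ∃ λ n → 0 < n × n ≤ k × HasOrder y n
  order-exists {y} y≉0 with ^-≈1-exists y≉0
  ... | suc m , _ , m<k , y¹⁺ᵐ≈1
    with ¬∀⟶∃¬-smallest k (λ i → y ^ suc (toℕ i) ≉ 1) (λ i → ¬? (y ^ suc (toℕ i) ≈? 1))
           (λ all≉1 → all≉1 (fromℕ< m<k) (subst (λ z → y ^ suc z ≈ 1) (sym (toℕ-fromℕ< m<k)) y¹⁺ᵐ≈1))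
  ... | i , ¬≉1 , earlier≉1 =
    n , z<s , toℕ<n i , record { ≈1⇒∣ = ≈1⇒n∣ ; ∣⇒≈1 = λ { (divides c refl) → multiple≈1 c } }
    where
    n : ℕ
    n = suc (toℕ i)
    yⁿ≈1 : y ^ n ≈ 1
    yⁿ≈1 = decidable-stable (y ^ n ≈? 1) ¬≉1
    multiple≈1 : ∀ c → y ^ (c * n) ≈ 1
    multiple≈1 c = subst (λ e → y ^ e ≈ 1) (*-comm n c) (^-*-≈1 n yⁿ≈1 c)
    minimal : ∀ {j} → j < toℕ i → y ^ suc j ≉ 1
    minimal j<i = subst (λ z → y ^ suc z ≉ 1) (trans (toℕ-inject (fromℕ< j<i)) (toℕ-fromℕ< j<i))
                        (earlier≉1 (fromℕ< j<i))
    ≈1⇒n∣ : ∀ {m} → y ^ m ≈ 1 → n ∣ m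
    ≈1⇒n∣ {m} yᵐ≈1 with m % n in m%n≡r
    ... | zero  = m%n≡0⇒n∣m m n m%n≡r
    ... | suc j = contradiction (subst (λ e → y ^ e ≈ 1) m%n≡r (≈-trans (≈-sym (^-%-≈ n yⁿ≈1 m)) yᵐ≈1))
                                (minimal (s<s⁻¹ (subst (_< n) m%n≡r (m%n<n m n))))

  HasOrder-unique : ∀ {y n n′} → HasOrder y n → HasOrder y n′ → n ≡ n′
  HasOrder-unique o o′ = ∣-antisym (≈1⇒∣ o (∣⇒≈1 o′ ∣-refl)) (≈1⇒∣ o′ (∣⇒≈1 o ∣-refl))

  HasOrder-cong : ∀ {x y n} → x ≈ y → HasOrder x n → HasOrder y n
  HasOrder-cong x≈y o = record
    { ≈1⇒∣ = λ {m} yᵐ≈1 → ≈1⇒∣ o (≈-trans (^-congˡ m x≈y) yᵐ≈1)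
    ; ∣⇒≈1 = λ {m} n∣m → ≈-trans (^-congˡ m (≈-sym x≈y)) (∣⇒≈1 o n∣m) }

  HasOrder⇒≉0 : ∀ {y n} → 0 < n → HasOrder y n → y ≉ 0
  HasOrder⇒≉0 {y} {suc n} _ o y≈0 = 1≉0 (begin
    1           ≈⟨ ∣⇒≈1 o ∣-refl ⟨
    y * y ^ n   ≈⟨ *-congʳ (y ^ n) y≈0 ⟩
    0           ∎)
    where open ≈-Reasoning

  HasOrder-^ : ∀ {y b} → HasOrder y b → ∀ t w → .{{_ : NonZero t}} → t * w ≡ b → HasOrder (y ^ t) w
  HasOrder-^ {y} o t w t*w≡b = record
    { ≈1⇒∣ = λ {m} e → *-cancelˡ-∣ t (subst (_∣ t * m) (sym t*w≡b)
                          (≈1⇒∣ o (subst (_≈ 1) (^-*-assoc y t m) e)))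
    ; ∣⇒≈1 = λ {m} w∣m → subst (_≈ 1) (sym (^-*-assoc y t m))
                          (∣⇒≈1 o (subst (_∣ t * m) t*w≡b (*-monoʳ-∣ t w∣m))) }

  HasOrder⇒^-injective : ∀ {g n a b} → HasOrder g n → a < n → b < n → g ^ a ≈ g ^ b → a ≡ b
  HasOrder⇒^-injective {g} {n} {a} {b} o a<n b<n gᵃ≈gᵇ =
    [ (λ a≤b → ordered a≤b b<n gᵃ≈gᵇ) , (λ b≤a → sym (ordered b≤a a<n (≈-sym gᵃ≈gᵇ))) ]′ (≤-total a b)
    where
    ordered : ∀ {x y} → x ≤ y → y < n → g ^ x ≈ g ^ y → x ≡ y
    ordered {x} {y} x≤y y<n gˣ≈gʸ = ≤-antisym x≤y (m∸n≡0⇒m≤n (small-multiple (y ∸ x) refl))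
      where
      g≉0 : g ≉ 0
      g≉0 = HasOrder⇒≉0 (≤-<-trans z≤n y<n) o
      gʸ⁻ˣ≈1 : g ^ (y ∸ x) ≈ 1
      gʸ⁻ˣ≈1 = ≈-sym (*-cancelˡ-≈ (g ^ x) (^-≉0 x g≉0) (begin
        g ^ x * 1            ≡⟨ *-identityʳ (g ^ x) ⟩
        g ^ x                ≈⟨ gˣ≈gʸ ⟩
        g ^ y                ≡⟨ cong (g ^_) (m+[n∸m]≡n x≤y) ⟨
        g ^ (x + (y ∸ x))    ≡⟨ ^-distribˡ-+-* g x (y ∸ x) ⟩
        g ^ x * g ^ (y ∸ x)  ∎))
        where open ≈-Reasoning
      small-multiple : ∀ d → d ≡ y ∸ x → d ≡ 0
      small-multiple zero    _    = refl
      small-multiple (suc d) d≡ = contradiction (subst (n ∣_) (sym d≡) (≈1⇒∣ o gʸ⁻ˣ≈1))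
                                                (>⇒∤ (subst (_< n) (sym d≡) (≤-<-trans (m∸n≤m y x) y<n)))

  HasOrder-* : ∀ {x y a b} → HasOrder x a → HasOrder y b → Coprime a b → HasOrder (x * y) (a * b)
  HasOrder-* {x} {y} {a} {b} oₓ oᵧ a⊥b = record
    { ≈1⇒∣ = λ {m} e → coprime⇒*∣ a⊥b (cofactor∣ oᵧ oₓ (Coprime.sym a⊥b) (subst (λ z → z ^ m ≈ 1) (*-comm x y) e))
                                  (cofactor∣ oₓ oᵧ a⊥b e)
    ; ∣⇒≈1 = λ {m} ab∣m → begin
        (x * y) ^ m     ≡⟨ ^-distribʳ-* x y m ⟩
        x ^ m * y ^ m   ≈⟨ *-cong (∣⇒≈1 oₓ (∣-trans (m∣m*n b) ab∣m)) (∣⇒≈1 oᵧ (∣-trans (n∣m*n a) ab∣m)) ⟩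
        1               ∎ }
    where
    open ≈-Reasoning
    -- Raising to the power c kills u, so what remains of (u v)ᵐ is vᵐᶜ.
    cofactor∣ : ∀ {u v c d m} → HasOrder u c → HasOrder v d → Coprime c d → (u * v) ^ m ≈ 1 → d ∣ m
    cofactor∣ {u} {v} {c} {d} {m} o-u o-v c⊥d e =
      coprime-divisor (Coprime.sym c⊥d) (subst (d ∣_) (*-comm m c) (≈1⇒∣ o-v (begin
        v ^ (m * c)                 ≡⟨ *-identityˡ (v ^ (m * c)) ⟨
        1 * v ^ (m * c)             ≈⟨ *-congʳ (v ^ (m * c)) (∣⇒≈1 o-u (n∣m*n m)) ⟨
        u ^ (m * c) * v ^ (m * c)   ≡⟨ ^-distribʳ-* u v (m * c) ⟨
        (u * v) ^ (m * c)           ≈⟨ ^-*-≈1 m e c ⟩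
        1                           ∎)))

  -- If qᵉ ∣ b but qᵉ ∤ a = qᶠ a′ with q ∤ a′, then f < e and x^(qᶠ) y^(b/qᵉ) has order a′ qᵉ > a.
  larger-order : ∀ {x a y b} → HasOrder x a → 0 < a → HasOrder y b → 0 < b → ¬ b ∣ a →
                 ∃₂ λ z N → a < N × HasOrder z N
  larger-order {x} {a} {y} {b} oₓ 0<a oᵧ 0<b b∤a with ∤⇒prime-power∤ b 0<b b∤a
  ... | q , q-prime , e , divides t b≡t*qᵉ , qᵉ∤a with factor-out q-prime a 0<a
  ...   | f , a′ , a≡qᶠa′ , q∤a′ =
    x ^ (q ^ f) * y ^ t , a′ * q ^ e , a<a′qᵉ ,
    HasOrder-* (HasOrder-^ oₓ (q ^ f) a′ (sym a≡qᶠa′)) (HasOrder-^ oᵧ t (q ^ e) t*qᵉ≡b)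
               (Coprime.sym (coprime-^ˡ (prime∤⇒coprime q-prime q∤a′) e))
    where
    1<q : 1 < q
    1<q = prime⇒1<p q-prime
    instance
      qᶠ≢0 : NonZero (q ^ f)
      qᶠ≢0 = m^n≢0 q f {{>-nonZero (<-trans z<s 1<q)}}
      t≢0 : NonZero t
      t≢0 = ≢-nonZero λ { refl → >⇒≢ 0<b b≡t*qᵉ }
    t*qᵉ≡b : t * q ^ e ≡ b
    t*qᵉ≡b = sym b≡t*qᵉ
    a≡a′qᶠ : a ≡ a′ * q ^ f
    a≡a′qᶠ = trans a≡qᶠa′ (*-comm (q ^ f) a′)
    f<e : f < e
    f<e with f <? e
    ... | yes f<e = f<e
    ... | no  f≮e = contradiction (∣-trans qᵉ∣qᶠ (divides a′ a≡a′qᶠ)) qᵉ∤a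
      where
      qᵉ∣qᶠ : q ^ e ∣ q ^ f
      qᵉ∣qᶠ = divides (q ^ (f ∸ e))
        (trans (cong (q ^_) (sym (m∸n+n≡m (≮⇒≥ f≮e)))) (^-distribˡ-+-* q (f ∸ e) e))
    0<a′ : 0 < a′
    0<a′ = n≢0⇒n>0 λ { refl → >⇒≢ 0<a (trans a≡a′qᶠ refl) }
    a<a′qᵉ : a < a′ * q ^ e
    a<a′qᵉ = subst (_< a′ * q ^ e) (sym a≡a′qᶠ) (*-monoʳ-< a′ {{>-nonZero 0<a′}} (^-monoʳ-< q 1<q f<e))

  -- Every order divides the largest one, M, so all k units are roots of yᴹ − 1, whence M = k.
  private
    0<k : 0 < k
    0<k = s≤s⁻¹ (prime⇒1<p p-prime)

    -- Opaque, so that type checking never unfolds the search for the orders.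
    opaque
      order : Fin k → ℕ
      order i = proj₁ (order-exists (residue≉0 i))

      0<order : ∀ i → 0 < order i
      0<order i = proj₁ (proj₂ (order-exists (residue≉0 i)))

      order≤k : ∀ i → order i ≤ k
      order≤k i = proj₁ (proj₂ (proj₂ (order-exists (residue≉0 i))))

      residue-order : ∀ i → HasOrder (residue i) (order i)
      residue-order i = proj₂ (proj₂ (proj₂ (order-exists (residue≉0 i))))

    i* : Fin k
    i* = proj₁ (argmax-Fin 0<k order)

    M : ℕ
    M = order i*

    order∣M : ∀ j → order j ∣ M
    order∣M j with order j ∣? M
    ... | yes order∣M = order∣M
    ... | no  order∤M with larger-order (residue-order i*) (0<order i*) (residue-order j) (0<order j) order∤M
    ...   | z , N , M<N , z-order = contradiction (proj₂ (argmax-Fin 0<k order) (index z z≉0)) (<⇒≱ M<order)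
      where
      z≉0 : z ≉ 0
      z≉0 = HasOrder⇒≉0 (≤-<-trans z≤n M<N) z-order
      M<order : M < order (index z z≉0)
      M<order = subst (M <_) (HasOrder-unique (HasOrder-cong (≈-sym (residue-index z z≉0)) z-order)
                                              (residue-order (index z z≉0))) M<N

    ^M≈1 : ∀ {y} → y ≉ 0 → y ^ M ≈ 1
    ^M≈1 {y} y≉0 = ∣⇒≈1 (HasOrder-cong (residue-index y y≉0) (residue-order (index y y≉0))) (order∣M (index y y≉0))

    k≤M : k ≤ M
    k≤M = subst (k ≤_) length≡M (monic-roots≤degree cs k residue residue-injective roots)
      where
      instance
        M≢0 : NonZero M
        M≢0 = >-nonZero (0<order i*)
      cs : List ℕ
      cs = k ∷ replicate (pred M) 0
      length≡M : length cs ≡ M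
      length≡M = trans (cong suc (length-replicate (pred M))) (suc-pred M)
      roots : ∀ i → evalMonic cs (residue i) ≈ 0
      roots i = begin
        k + y * evalMonic (replicate (pred M) 0) y ≡⟨ cong (λ z → k + y * z) (evalMonic-replicate (pred M) y) ⟩
        k + y * y ^ pred M                        ≡⟨ cong (λ e → k + y ^ e) (suc-pred M) ⟩
        k + y ^ M                                 ≈⟨ +-cong ≈-refl (^M≈1 (residue≉0 i)) ⟩
        k + 1                                     ≡⟨ +-comm k 1 ⟩
        suc k                                     ≈⟨ ∣⇒≈0 ∣-refl ⟩
        0                                         ∎
        where
        open ≈-Reasoning
        y : ℕ
        y = residue i

    M≡k : M ≡ k
    M≡k = ≤-antisym (order≤k i*) k≤M

  primitive-root : ∃ λ g → HasOrder g k
  primitive-root = residue i* , subst (HasOrder (residue i*)) M≡k (residue-order i*)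

  fermat : ∀ {y} → y ≉ 0 → y ^ k ≈ 1
  fermat {y} y≉0 = subst (λ e → y ^ e ≈ 1) M≡k (^M≈1 y≉0)

  instance
    k≢0 : NonZero k
    k≢0 = >-nonZero 0<k

  k≉0 : k ≉ 0
  k≉0 = 0<m<p⇒m≉0 0<k (n<1+n k)

  -- An inverse only when y ≉ 0.
  _⁻¹ : ℕ → ℕ
  y ⁻¹ = y ^ pred k

  *-inverseʳ : ∀ {y} → y ≉ 0 → y * y ⁻¹ ≈ 1
  *-inverseʳ {y} y≉0 = ≈-trans (≈-reflexive (cong (y ^_) (suc-pred k))) (fermat y≉0)

  -- k is −1 modulo p.
  x+ky≈0⇒x≈y : ∀ {x y} → x + k * y ≈ 0 → x ≈ y
  x+ky≈0⇒x≈y {x} {y} x+ky≈0 = begin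
    x                  ≡⟨ +-identityʳ x ⟨
    x + 0              ≈⟨ +-cong ≈-refl (n*x≈0 y) ⟨
    x + suc k * y      ≡⟨ rearrange x y k ⟩
    x + k * y + y      ≈⟨ +-cong x+ky≈0 ≈-refl ⟩
    y                  ∎
    where
    open ≈-Reasoning
    rearrange : ∀ x y k → x + (1 + k) * y ≡ x + k * y + y
    rearrange = solve-∀

  %+%-negation : ∀ {x} → x ≉ 0 → x % suc k + (k * x) % suc k ≡ suc k
  %+%-negation {x} x≉0 with ≈0⇒∣ (≈-trans (+-cong (%-≈ x) (%-≈ (k * x))) (n*x≈0 x))
  ... | divides zero          u+w≡0      = contradiction (m+n≡0⇒m≡0 _ u+w≡0) (≉0⇒%≢0 x≉0)
  ... | divides (suc zero)    u+w≡p      = trans u+w≡p (+-identityʳ (suc k))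
  ... | divides (suc (suc c)) u+w≡[2+c]p = contradiction
    (subst (suc k + suc k ≤_) (sym u+w≡[2+c]p) (+-monoʳ-≤ (suc k) (m≤m+n (suc k) (c * suc k))))
    (<⇒≱ (+-mono-< (m%n<n x (suc k)) (m%n<n (k * x) (suc k))))

  *-inverseˡ : ∀ {y} → y ≉ 0 → y ⁻¹ * y ≈ 1
  *-inverseˡ {y} y≉0 = ≈-trans (≈-reflexive (*-comm (y ⁻¹) y)) (*-inverseʳ y≉0)

  character-sum-≈ : ∀ {y z} → z ≉ 0 → y ≈ z → sumFin k (λ j → (z ⁻¹) ^ toℕ j * y ^ toℕ j) ≈ k
  character-sum-≈ {y} {z} z≉0 y≈z = begin
    sumFin k (λ j → (z ⁻¹) ^ toℕ j * y ^ toℕ j) ≈⟨ sumFin-cong-≈ k term≈1 ⟩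
    sumFin k (λ _ → 1)                        ≡⟨ trans (sumFin-const k 1) (*-identityʳ k) ⟩
    k                                         ∎
    where
    open ≈-Reasoning
    term≈1 : ∀ j → (z ⁻¹) ^ toℕ j * y ^ toℕ j ≈ 1
    term≈1 j = begin
      (z ⁻¹) ^ toℕ j * y ^ toℕ j ≡⟨ ^-distribʳ-* (z ⁻¹) y (toℕ j) ⟨
      (z ⁻¹ * y) ^ toℕ j        ≈⟨ ^-congˡ (toℕ j) (≈-trans (*-congˡ (z ⁻¹) y≈z) (*-inverseˡ z≉0)) ⟩
      1 ^ toℕ j                 ≡⟨ ^-zeroˡ (toℕ j) ⟩
      1                         ∎

  character-sum-≉ : ∀ {y z} → y ≉ 0 → z ≉ 0 → y ≉ z → sumFin k (λ j → (z ⁻¹) ^ toℕ j * y ^ toℕ j) ≈ 0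
  character-sum-≉ {y} {z} y≉0 z≉0 y≉z = begin
    sumFin k (λ j → (z ⁻¹) ^ toℕ j * y ^ toℕ j) ≡⟨ sumFin-cong k (λ j → ^-distribʳ-* (z ⁻¹) y (toℕ j)) ⟨
    sumFin k (λ j → (z ⁻¹ * y) ^ toℕ j)       ≈⟨ geometric-sum≈0 k (fermat z⁻¹y≉0) z⁻¹y≉1 ⟩
    0                                         ∎
    where
    open ≈-Reasoning
    z⁻¹≉0 : z ⁻¹ ≉ 0
    z⁻¹≉0 = ^-≉0 (pred k) z≉0
    z⁻¹y≉0 : z ⁻¹ * y ≉ 0
    z⁻¹y≉0 = *-≉0 z⁻¹≉0 y≉0
    z⁻¹y≉1 : z ⁻¹ * y ≉ 1
    z⁻¹y≉1 z⁻¹y≈1 = y≉z (*-cancelˡ-≈ (z ⁻¹) z⁻¹≉0 (≈-trans z⁻¹y≈1 (≈-sym (*-inverseˡ z≉0))))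

  ^-diffIdx : ∀ {y} → y ≉ 0 → (i j : Fin k) → y ^ toℕ (diffIdx i j) ≈ y ^ toℕ i * (y ⁻¹) ^ toℕ j
  ^-diffIdx {y} y≉0 i j = *-cancelʳ-≈ (y ^ J) (^-≉0 J y≉0) (begin
    y ^ toℕ (diffIdx i j) * y ^ J  ≡⟨ cong (λ e → y ^ e * y ^ J) (toℕ-diffIdx i j) ⟩
    y ^ ((I + k ∸ J) % k) * y ^ J  ≈⟨ *-congʳ (y ^ J) (^-%-≈ k (fermat y≉0) (I + k ∸ J)) ⟨
    y ^ (I + k ∸ J) * y ^ J        ≡⟨ ^-distribˡ-+-* y (I + k ∸ J) J ⟨
    y ^ (I + k ∸ J + J)            ≡⟨ cong (y ^_) (m∸n+n≡m (≤-trans (<⇒≤ (toℕ<n j)) (m≤n+m k I))) ⟩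
    y ^ (I + k)                    ≡⟨ ^-distribˡ-+-* y I k ⟩
    y ^ I * y ^ k                  ≈⟨ *-congˡ (y ^ I) (fermat y≉0) ⟩
    y ^ I * 1                      ≡⟨ cong (y ^ I *_) (^-zeroˡ J) ⟨
    y ^ I * 1 ^ J                  ≈⟨ *-congˡ (y ^ I) (^-congˡ J (*-inverseˡ y≉0)) ⟨
    y ^ I * (y ⁻¹ * y) ^ J         ≡⟨ cong (y ^ I *_) (^-distribʳ-* (y ⁻¹) y J) ⟩
    y ^ I * ((y ⁻¹) ^ J * y ^ J)   ≡⟨ *-assoc (y ^ I) ((y ⁻¹) ^ J) (y ^ J) ⟨
    y ^ I * (y ⁻¹) ^ J * y ^ J     ∎)
    where
    open ≈-Reasoning
    I : ℕ
    I = toℕ i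
    J : ℕ
    J = toℕ j

-- Circulant matrices

module Circulant (k : ℕ) (p-prime : Prime (suc k)) where

  open Units k p-prime

  module _ {r : ℕ} (ρ c : Fin r → ℕ) (ρ≉0 : ∀ t → ρ t ≉ 0) (ρ-injective : ∀ t u → ρ t ≈ ρ u → t ≡ u)
           (c≉0 : ∀ t → c t ≉ 0) (a : Fin k → ℕ)
           (a≈ : ∀ i → a i ≈ sumFin r (λ t → c t * ρ t ^ toℕ i)) where

    φ : (Fin r → ℕ) → Fin k → ℕ
    φ x i = sumFin r (λ t → x t * ρ t ^ toℕ i)

    φ-cong : ∀ {x y} → (∀ t → x t ≈ y t) → ∀ i → φ x i ≈ φ y i
    φ-cong x≈y i = sumFin-cong-≈ r (λ t → *-congʳ (ρ t ^ toℕ i) (x≈y t))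

    φ-+ : ∀ x y i → φ (λ t → x t + y t) i ≡ φ x i + φ y i
    φ-+ x y i = trans (sumFin-cong r (λ t → *-distribʳ-+ (ρ t ^ toℕ i) (x t) (y t)))
                      (sumFin-distrib-+ r (λ t → x t * ρ t ^ toℕ i) (λ t → y t * ρ t ^ toℕ i))


    φ-coefficient : ∀ x u → sumFin k (λ i → φ x i * (ρ u ⁻¹) ^ toℕ i) ≈ x u * k
    φ-coefficient x u = begin
      sumFin k (λ i → φ x i * (ρ u ⁻¹) ^ toℕ i)
        ≡⟨ sumFin-cong k (λ i → *-comm (φ x i) ((ρ u ⁻¹) ^ toℕ i)) ⟩
      sumFin k (λ i → (ρ u ⁻¹) ^ toℕ i * φ x i)
        ≡⟨ sumFin-exchange k r (λ i → (ρ u ⁻¹) ^ toℕ i) x (λ i t → ρ t ^ toℕ i) ⟩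
      sumFin r (λ t → x t * sumFin k (λ i → (ρ u ⁻¹) ^ toℕ i * ρ t ^ toℕ i))
        ≈⟨ sumFin-delta r _ u (λ t t≢u → ≈-trans
             (*-congˡ (x t) (character-sum-≉ (ρ≉0 t) (ρ≉0 u) (t≢u ∘ ρ-injective t u)))
             (≈-reflexive (*-zeroʳ (x t)))) ⟩
      x u * sumFin k (λ i → (ρ u ⁻¹) ^ toℕ i * ρ u ^ toℕ i)
        ≈⟨ *-congˡ (x u) (character-sum-≈ (ρ≉0 u) ≈-refl) ⟩
      x u * k ∎
      where open ≈-Reasoning

    φ-injective : ∀ x y → (∀ i → φ x i ≈ φ y i) → ∀ t → x t ≈ y t
    φ-injective x y φx≈φy t = *-cancelʳ-≈ k k≉0 (begin
      x t * k                                   ≈⟨ φ-coefficient x t ⟨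
      sumFin k (λ i → φ x i * (ρ t ⁻¹) ^ toℕ i) ≈⟨ sumFin-cong-≈ k (λ i → *-congʳ ((ρ t ⁻¹) ^ toℕ i) (φx≈φy i)) ⟩
      sumFin k (λ i → φ y i * (ρ t ⁻¹) ^ toℕ i) ≈⟨ φ-coefficient y t ⟩
      y t * k                                   ∎)
      where open ≈-Reasoning

    circulant-φ : ∀ d i → sumFin k (λ j → d j * a (diffIdx i j)) ≈
                          φ (λ t → c t * sumFin k (λ j → d j * (ρ t ⁻¹) ^ toℕ j)) i
    circulant-φ d i = begin
      sumFin k (λ j → d j * a (diffIdx i j))
        ≈⟨ sumFin-cong-≈ k (λ j → *-congˡ (d j) (a-diffIdx j)) ⟩
      sumFin k (λ j → d j * sumFin r (λ t → c t * ρ t ^ toℕ i * (ρ t ⁻¹) ^ toℕ j))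
        ≡⟨ sumFin-exchange k r d (λ t → c t * ρ t ^ toℕ i) (λ j t → (ρ t ⁻¹) ^ toℕ j) ⟩
      sumFin r (λ t → c t * ρ t ^ toℕ i * sumFin k (λ j → d j * (ρ t ⁻¹) ^ toℕ j))
        ≡⟨ sumFin-cong r (λ t → xyz≡xzy (c t) (ρ t ^ toℕ i) _) ⟩
      φ (λ t → c t * sumFin k (λ j → d j * (ρ t ⁻¹) ^ toℕ j)) i ∎
      where
      open ≈-Reasoning
      xyz≡xzy : ∀ x y z → x * y * z ≡ x * z * y
      xyz≡xzy = solve-∀
      a-diffIdx : ∀ j → a (diffIdx i j) ≈ sumFin r (λ t → c t * ρ t ^ toℕ i * (ρ t ⁻¹) ^ toℕ j)
      a-diffIdx j = ≈-trans (a≈ (diffIdx i j)) (sumFin-cong-≈ r λ t →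
        ≈-trans (*-congˡ (c t) (^-diffIdx (ρ≉0 t) i j)) (≈-reflexive (sym (*-assoc (c t) _ _))))

    φ-in-column-space : ∀ x i → let γ = λ t → x t * (c t * k) ⁻¹ in
                        sumFin k (λ j → φ γ j * a (diffIdx i j)) ≈ φ x i
    φ-in-column-space x i = begin
      sumFin k (λ j → φ γ j * a (diffIdx i j))                           ≈⟨ circulant-φ (φ γ) i ⟩
      φ (λ t → c t * sumFin k (λ j → φ γ j * (ρ t ⁻¹) ^ toℕ j)) i       ≈⟨ φ-cong cγk≈x i ⟩
      φ x i                                                             ∎
      where
      open ≈-Reasoning
      γ : Fin r → ℕ
      γ = λ t → x t * (c t * k) ⁻¹
      rearrange : ∀ c x e k → c * (x * e * k) ≡ x * (c * k * e)
      rearrange = solve-∀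
      cγk≈x : ∀ t → c t * sumFin k (λ j → φ γ j * (ρ t ⁻¹) ^ toℕ j) ≈ x t
      cγk≈x t = begin
        c t * sumFin k (λ j → φ γ j * (ρ t ⁻¹) ^ toℕ j) ≈⟨ *-congˡ (c t) (φ-coefficient γ t) ⟩
        c t * (x t * (c t * k) ⁻¹ * k)                  ≡⟨ rearrange (c t) (x t) ((c t * k) ⁻¹) k ⟩
        x t * (c t * k * (c t * k) ⁻¹)                  ≈⟨ *-congˡ (x t) (*-inverseʳ (*-≉0 (c≉0 t) k≉0)) ⟩
        x t * 1                                         ≡⟨ *-identityʳ (x t) ⟩
        x t                                             ∎

    N≅Cₚʳ : NIsoCyclicPower k (suc k) a r
    N≅Cₚʳ = record
      { φ         = φ
      ; resp      = λ x y x≈y i → congruent (φ-cong {x} {y} (λ t → mk≈ {x t} {y t} (x≈y t)) i)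
      ; additive  = λ x y i → cong (_% suc k) (φ-+ x y i)
      ; injective = λ x y φx≈φy t → congruent (φ-injective x y (λ i → mk≈ (φx≈φy i)) t)
      ; into      = λ x → φ (λ t → x t * (c t * k) ⁻¹) , λ i → congruent (≈-sym (φ-in-column-space x i))
      ; onto      = λ v (d , v≈Cd) → (λ t → c t * sumFin k (λ j → d j * (ρ t ⁻¹) ^ toℕ j)) ,
                      λ i → congruent (≈-sym (≈-trans (mk≈ {v i} (v≈Cd i)) (circulant-φ d i)))
      }

-- Lifting residues to k-gons

module Lifting (k : ℕ) (p-prime : Prime (suc k)) (3≤k : 3 ≤ k) where

  open Units k p-prime

  residues⇒KGon : (s : Fin k → ℕ) → (∀ i → 0 < s i) → (∀ i → s i < suc k) →
                  ∀ m → sumFin k s ≡ m * suc k → m ≤ k ∸ 2 →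
                  ∃ λ a → IsKGon k (suc k) a × ∀ i → a i ≈ s i
  residues⇒KGon s 0<s s<p m Σs≡mp m≤k-2 = a , gon , a≈s
    where
    p : ℕ
    p = suc k
    L : ℕ
    L = k ∸ 2 ∸ m
    a : Fin k → ℕ
    a i = s i + below (toℕ i) L * p

    a≈s : ∀ i → a i ≈ s i
    a≈s i = ≈-trans (+-cong ≈-refl (≈-trans (≈-reflexive (*-comm b p)) (n*x≈0 b))) (≈-reflexive (+-identityʳ (s i)))
      where
      b : ℕ
      b = below (toℕ i) L

    sumCond : sumFin k a ≡ (k ∸ 2) * p
    sumCond = begin
      sumFin k a                                         ≡⟨ sumFin-distrib-+ k s (λ i → below (toℕ i) L * p) ⟩
      sumFin k s + sumFin k (λ i → below (toℕ i) L * p) ≡⟨ cong₂ _+_ Σs≡mp (sym (*-distribʳ-sumFin k p (λ i → below (toℕ i) L))) ⟩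
      m * p + sumFin k (λ i → below (toℕ i) L) * p      ≡⟨ cong (λ z → m * p + z * p) (sumFin-below k L (≤-trans (m∸n≤m (k ∸ 2) m) (m∸n≤m k 2))) ⟩
      m * p + L * p                                     ≡⟨ *-distribʳ-+ p m L ⟨
      (m + L) * p                                       ≡⟨ cong (_* p) (m+[n∸m]≡n m≤k-2) ⟩
      (k ∸ 2) * p                                       ∎
      where open ≡-Reasoning

    lift-bounds : ∀ i → a i < 2 * p × a i ≢ p
    lift-bounds i with below (toℕ i) L | below≤1 (toℕ i) L
    ... | zero     | _ = subst (λ z → z < 2 * p × z ≢ p) (sym (+-identityʳ (s i)))
                           (≤-trans (s<p i) (m≤m+n p (p + 0)) , <⇒≢ (s<p i))
    ... | suc zero | _ = subst (λ z → s i + z < 2 * p × s i + z ≢ p) (sym (+-identityʳ p))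
                           (subst (s i + p <_) (cong (p +_) (sym (+-identityʳ p))) (+-monoˡ-< p (s<p i)) ,
                            >⇒≢ (m<n+m p (0<s i)))
    ... | suc (suc _) | s≤s ()

    coprime : gcdAll k a p ≡ 1
    coprime with prime⇒irreducible p-prime (gcdAll∣n k a p)
    ... | inj₁ gcd≡1 = gcd≡1
    ... | inj₂ gcd≡p = contradiction (≈-trans (≈-sym (a≈s i₀)) (∣⇒≈0 (subst (_∣ a i₀) gcd≡p (gcdAll∣a k a p i₀))))
                                     (0<m<p⇒m≉0 (0<s i₀) (s<p i₀))
      where
      i₀ : Fin k
      i₀ = fromℕ< (≤-trans (s≤s z≤n) 3≤k)

    gon : IsKGon k p a
    gon = record
      { k≥3 = 3≤k ; sumCond = sumCond ; positive = λ i → ≤-trans (0<s i) (m≤m+n (s i) _)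
      ; bound = proj₁ ∘ lift-bounds ; notN = proj₂ ∘ lift-bounds ; coprime = coprime }

  -- Multiplying by k ≡ −1 sends each residue s ∈ (0, p) to p − s, so the residue sums
  -- for σ = 1 and σ = k add up to k p; one of them is at most (k − 2) p.
  scaled-residues : (w : Fin k → ℕ) → (∀ i → w i ≉ 0) → sumFin k w ≈ 0 →
    ∃ λ σ → σ ≉ 0 × ∃ λ m → sumFin k (λ i → (σ * w i) % suc k) ≡ m * suc k × m ≤ k ∸ 2
  scaled-residues w w≉0 Σw≈0 = choose (S 1 / p ≤? k ∸ 2)
    where
    p : ℕ
    p = suc k
    S : ℕ → ℕ
    S σ = sumFin k (λ i → (σ * w i) % p)

    p∣S : ∀ σ → p ∣ S σ
    p∣S σ = ≈0⇒∣ (begin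
      S σ                          ≈⟨ sumFin-cong-≈ k (λ i → %-≈ (σ * w i)) ⟩
      sumFin k (λ i → σ * w i)     ≡⟨ *-distribˡ-sumFin k σ w ⟨
      σ * sumFin k w               ≈⟨ *-congˡ σ Σw≈0 ⟩
      σ * 0                        ≡⟨ *-zeroʳ σ ⟩
      0                            ∎)
      where open ≈-Reasoning

    S≡[S/p]p : ∀ σ → S σ ≡ S σ / p * p
    S≡[S/p]p σ = sym (m/n*n≡m (p∣S σ))

    S₁+Sₖ≡kp : S 1 + S k ≡ k * p
    S₁+Sₖ≡kp = begin
      S 1 + S k                                        ≡⟨ sumFin-distrib-+ k _ _ ⟨
      sumFin k (λ i → (1 * w i) % p + (k * w i) % p)  ≡⟨ sumFin-cong k (λ i → trans
                                                           (cong (λ z → z % p + (k * w i) % p) (*-identityˡ (w i)))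
                                                           (%+%-negation (w≉0 i))) ⟩
      sumFin k (λ _ → p)                               ≡⟨ sumFin-const k p ⟩
      k * p                                            ∎
      where open ≡-Reasoning

    q₁+qₖ≡k : S 1 / p + S k / p ≡ k
    q₁+qₖ≡k = *-cancelʳ-≡ _ _ p
      (trans (*-distribʳ-+ p (S 1 / p) (S k / p)) (trans (cong₂ _+_ (sym (S≡[S/p]p 1)) (sym (S≡[S/p]p k))) S₁+Sₖ≡kp))

    choose : Dec (S 1 / p ≤ k ∸ 2) →
             ∃ λ σ → σ ≉ 0 × ∃ λ m → S σ ≡ m * p × m ≤ k ∸ 2
    choose (yes q₁≤k-2) = 1 , 1≉0 , S 1 / p , S≡[S/p]p 1 , q₁≤k-2
    choose (no  q₁≰k-2) = k , k≉0 , S k / p , S≡[S/p]p k , ≤-trans qₖ≤1 (∸-monoˡ-≤ 2 3≤k)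
      where
      k≡1+[1+[k-2]] : k ≡ 1 + suc (k ∸ 2)
      k≡1+[1+[k-2]] = sym (m+[n∸m]≡n (≤-trans (s≤s (s≤s z≤n)) 3≤k))
      qₖ≤1 : S k / p ≤ 1
      qₖ≤1 = +-cancelʳ-≤ (suc (k ∸ 2)) (S k / p) 1 (begin
        S k / p + suc (k ∸ 2)  ≤⟨ +-monoʳ-≤ (S k / p) (≰⇒> q₁≰k-2) ⟩
        S k / p + S 1 / p      ≡⟨ trans (+-comm (S k / p) (S 1 / p)) (trans q₁+qₖ≡k k≡1+[1+[k-2]]) ⟩
        1 + suc (k ∸ 2)        ∎)
        where open ≤-Reasoning

  zero-sum⇒KGon : (w : Fin k → ℕ) → (∀ i → w i ≉ 0) → sumFin k w ≈ 0 →
                  ∃ λ σ → σ ≉ 0 × ∃ λ a → IsKGon k (suc k) a × ∀ i → a i ≈ σ * w i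
  zero-sum⇒KGon w w≉0 Σw≈0 =
    let σ , σ≉0 , m , Σ≡mp , m≤k-2 = scaled-residues w w≉0 Σw≈0
        a , gon , a≈s = residues⇒KGon (λ i → (σ * w i) % suc k)
                          (λ i → n≢0⇒n>0 (≉0⇒%≢0 (*-≉0 σ≉0 (w≉0 i))))
                          (λ i → m%n<n (σ * w i) (suc k)) m Σ≡mp m≤k-2
    in σ , σ≉0 , a , gon , λ i → ≈-trans (a≈s i) (%-≈ (σ * w i))

-- The construction

module Construction (k : ℕ) (p-prime : Prime (suc k)) (3≤k : 3 ≤ k) (n : ℕ) (2r<k : 2 * suc n < k) where

  open Units k p-prime
  open Lifting k p-prime 3≤k
  open Circulant k p-prime

  r : ℕ
  r = suc n

  g : ℕ
  g = proj₁ primitive-root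

  g-order : HasOrder g k
  g-order = proj₂ primitive-root

  g≉0 : g ≉ 0
  g≉0 = HasOrder⇒≉0 (≤-trans (s≤s z≤n) 3≤k) g-order

  gᵐ≈1⇒2∣m : ∀ {m} → g ^ m ≈ 1 → 2 ∣ m
  gᵐ≈1⇒2∣m = ∣-trans (odd-prime⇒even 3≤k p-prime) ∘ ≈1⇒∣ g-order

  E : Fin r → ℕ
  E t = suc (2 * toℕ t)

  ρ : Fin r → ℕ
  ρ t = g ^ E t

  ρ≉0 : ∀ t → ρ t ≉ 0
  ρ≉0 t = ^-≉0 (E t) g≉0

  ρ≉1 : ∀ t → ρ t ≉ 1
  ρ≉1 t = 2∤1+2m (toℕ t) ∘ gᵐ≈1⇒2∣m

  E<k : ∀ t → E t < k
  E<k t = ≤-trans (s≤s (s≤s (*-monoʳ-≤ 2 (s≤s⁻¹ (toℕ<n t))))) (≤-trans (≤-reflexive 2+2n≡2[1+n]) (<⇒≤ 2r<k))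
    where
    2+2n≡2[1+n] : 2 + 2 * n ≡ 2 * suc n
    2+2n≡2[1+n] = sym (*-distribˡ-+ 2 1 n)

  ρ-injective : ∀ t u → ρ t ≈ ρ u → t ≡ u
  ρ-injective t u ρt≈ρu = toℕ-injective (*-cancelˡ-≡ (toℕ t) (toℕ u) 2
    (suc-injective (HasOrder⇒^-injective g-order (E<k t) (E<k u) ρt≈ρu)))

  β : Fin r → ℕ
  β t = (n C toℕ t) * (k * g) ^ (n ∸ toℕ t)

  β≉0 : ∀ t → β t ≉ 0
  β≉0 t = *-≉0 (C-≉0 n<p (s≤s⁻¹ (toℕ<n t))) (^-≉0 (n ∸ toℕ t) (*-≉0 k≉0 g≉0))
    where
    n<p : n < suc k
    n<p = <-trans (n<1+n n) (≤-<-trans (m≤m+n r (r + 0)) (<-trans 2r<k (n<1+n k)))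

  v : ℕ → ℕ
  v i = sumFin r (λ t → β t * ρ t ^ i)

  -- Since k ≡ −1, this is vᵢ = gⁱ (g²ⁱ − g)ⁿ.
  v-closed : ∀ i → v i ≡ g ^ i * (g ^ (2 * i) + k * g) ^ n
  v-closed i = sym (begin
    g ^ i * (X + Y) ^ n
      ≡⟨ cong (g ^ i *_) (binomial-theorem n X Y) ⟩
    g ^ i * sumFin r (λ t → (n C toℕ t) * (X ^ toℕ t * Y ^ (n ∸ toℕ t)))
      ≡⟨ *-distribˡ-sumFin r (g ^ i) (λ t → (n C toℕ t) * (X ^ toℕ t * Y ^ (n ∸ toℕ t))) ⟩
    sumFin r (λ t → g ^ i * ((n C toℕ t) * (X ^ toℕ t * Y ^ (n ∸ toℕ t))))
      ≡⟨ sumFin-cong r term ⟩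
    v i ∎)
    where
    open ≡-Reasoning
    X : ℕ
    X = g ^ (2 * i)
    Y : ℕ
    Y = k * g
    rearrange : ∀ a c x y → a * (c * (x * y)) ≡ c * y * (a * x)
    rearrange = solve-∀
    exponent : ∀ i t → i + 2 * i * t ≡ (1 + 2 * t) * i
    exponent = solve-∀
    gⁱXᵗ≡ρᵗⁱ : ∀ t → g ^ i * X ^ toℕ t ≡ ρ t ^ i
    gⁱXᵗ≡ρᵗⁱ t = begin
      g ^ i * X ^ toℕ t           ≡⟨ cong (g ^ i *_) (^-*-assoc g (2 * i) (toℕ t)) ⟩
      g ^ i * g ^ (2 * i * toℕ t) ≡⟨ ^-distribˡ-+-* g i (2 * i * toℕ t) ⟨
      g ^ (i + 2 * i * toℕ t)     ≡⟨ cong (g ^_) (exponent i (toℕ t)) ⟩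
      g ^ (E t * i)               ≡⟨ ^-*-assoc g (E t) i ⟨
      ρ t ^ i                     ∎
    term : ∀ t → g ^ i * ((n C toℕ t) * (X ^ toℕ t * Y ^ (n ∸ toℕ t))) ≡ β t * ρ t ^ i
    term t = trans (rearrange (g ^ i) (n C toℕ t) (X ^ toℕ t) (Y ^ (n ∸ toℕ t))) (cong (β t *_) (gⁱXᵗ≡ρᵗⁱ t))

  v≉0 : ∀ i → v i ≉ 0
  v≉0 i = subst (_≉ 0) (sym (v-closed i)) (*-≉0 (^-≉0 i g≉0) (^-≉0 n g²ⁱ+kg≉0))
    where
    2∤pred-k : ¬ 2 ∣ pred k
    2∤pred-k 2∣k-1 = contradiction (∣1⇒≡1 (∣m+n∣m⇒∣n (subst (2 ∣_) k≡pred-k+1 (odd-prime⇒even 3≤k p-prime)) 2∣k-1)) λ ()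
      where
      k≡pred-k+1 : k ≡ pred k + 1
      k≡pred-k+1 = trans (sym (suc-pred k)) (+-comm 1 (pred k))
    -- g²ⁱ ≈ g would give g²ⁱ⁺ᵏ⁻¹ ≈ gᵏ ≈ 1 with 2i + k − 1 odd.
    g²ⁱ+kg≉0 : g ^ (2 * i) + k * g ≉ 0
    g²ⁱ+kg≉0 e = 2∤pred-k (∣m+n∣m⇒∣n (gᵐ≈1⇒2∣m (begin
      g ^ (2 * i + pred k)       ≡⟨ ^-distribˡ-+-* g (2 * i) (pred k) ⟩
      g ^ (2 * i) * g ⁻¹         ≈⟨ *-congʳ (g ⁻¹) (x+ky≈0⇒x≈y e) ⟩
      g * g ⁻¹                   ≈⟨ *-inverseʳ g≉0 ⟩
      1                          ∎)) (m∣m*n i))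
      where open ≈-Reasoning

  Σv≈0 : sumFin k (λ i → v (toℕ i)) ≈ 0
  Σv≈0 = begin
    sumFin k (λ i → sumFin r (λ t → β t * ρ t ^ toℕ i))     ≡⟨ sumFin-swap k r (λ i t → β t * ρ t ^ toℕ i) ⟩
    sumFin r (λ t → sumFin k (λ i → β t * ρ t ^ toℕ i))     ≡⟨ sumFin-cong r (λ t → *-distribˡ-sumFin k (β t) (λ i → ρ t ^ toℕ i)) ⟨
    sumFin r (λ t → β t * sumFin k (λ i → ρ t ^ toℕ i))     ≈⟨ sumFin-cong-≈ r (λ t → *-congˡ (β t) (geometric-sum≈0 k (fermat (ρ≉0 t)) (ρ≉1 t))) ⟩
    sumFin r (λ t → β t * 0)                                ≡⟨ trans (sumFin-cong r (λ t → *-zeroʳ (β t))) (sumFin-zero r) ⟩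
    0                                                       ∎
    where open ≈-Reasoning

  kgon-of-rank : ∃ λ a → IsKGon k (suc k) a × NIsoCyclicPower k (suc k) a r
  kgon-of-rank =
    let σ , σ≉0 , a , gon , a≈σv = zero-sum⇒KGon (λ i → v (toℕ i)) (λ i → v≉0 (toℕ i)) Σv≈0
    in a , gon , N≅Cₚʳ ρ (λ t → σ * β t) ρ≉0 ρ-injective (λ t → *-≉0 σ≉0 (β≉0 t)) a
                   (λ i → ≈-trans (a≈σv i) (≈-reflexive (σv≡ σ (toℕ i))))
    where
    σv≡ : ∀ σ i → σ * v i ≡ sumFin r (λ t → σ * β t * ρ t ^ i)
    σv≡ σ i = trans (*-distribˡ-sumFin r σ (λ t → β t * ρ t ^ i)) (sumFin-cong r (λ t → sym (*-assoc σ (β t) (ρ t ^ i))))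

kgon-of-monodromy-rank : ∀ k → 3 ≤ k → Prime (suc k) → ∀ r → 0 < r → 2 * r < k →
                         ∃ λ a → IsKGon k (suc k) a × NIsoCyclicPower k (suc k) a r
kgon-of-monodromy-rank k 3≤k p-prime (suc n) _ 2r<k = Construction.kgon-of-rank k p-prime 3≤k n 2r<k

proposition12 : (k : ℕ) → 3 ≤ k → Prime (suc k) →
    (d : ℕ) → k < 2 * d → d < k →
    ∃ λ (a : Fin k → ℕ) → IsKGon k (suc k) a × NIsoCyclicPower k (suc k) a (k ∸ d)
proposition12 k 3≤k p-prime d k<2d d<k =
  kgon-of-monodromy-rank k 3≤k p-prime (k ∸ d) (m<n⇒0<n∸m d<k) 2[k-d]<k
  where
  2[k-d]+2d≡k+k : 2 * (k ∸ d) + 2 * d ≡ k + k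
  2[k-d]+2d≡k+k = begin
    2 * (k ∸ d) + 2 * d ≡⟨ *-distribˡ-+ 2 (k ∸ d) d ⟨
    2 * (k ∸ d + d)     ≡⟨ cong (2 *_) (m∸n+n≡m (<⇒≤ d<k)) ⟩
    2 * k               ≡⟨ cong (k +_) (+-identityʳ k) ⟩
    k + k               ∎
    where open ≡-Reasoning
  2[k-d]<k : 2 * (k ∸ d) < k
  2[k-d]<k = +-cancelʳ-< (2 * d) (2 * (k ∸ d)) k (subst (_< k + 2 * d) (sym 2[k-d]+2d≡k+k) (+-monoʳ-< k k<2d))
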